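{- Let $G$ be a finite simple connected graph with edge set $E$. Then $$X_3(G)=\sum_{(i,j)\in E}(d_i+d_j)^3 \ge \frac{\{F(G)+2M_2(G)\}^2}{M_1(G)} = \frac{\{d^T Q d\}^2}{M_1(G)},$$ with equality if $G$ is regular or semiregular.
   Context: All graphs are finite, simple and connected with $n\ge 3$ vertices $v_1,\dots,v_n$; $d_i$ is the degree of $v_i$, $d=(d_1,\dots,d_n)^T$ is the degree vector, and $(i,j)$ denotes the edge joining $v_i$ and $v_j$. $M_1(G)=\sum_i d_i^2$, $M_2(G)=\sum_{(i,j)\in E} d_id_j$, $F(G)=\sum_i d_i^3$. $Q=D+A$ is the signless Laplacian matrix, with $A$ the adjacency matrix and $D$ the diagonal matrix of degrees. A graph is regular if all vertices have the same degree. A connected graph is bidegreed with degrees $\Delta>\delta$ if every vertex has degree $\Delta$ or $\delta$ and both occur; a semiregular graph is a connected bidegreed bipartite graph in which all vertices in the same part of the bipartition have the same degree. -}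

module Defs where

open import Data.Nat using (ℕ; zero; suc; _+_; _*_; _^_; _<_; _≤_; _<?_)
open import Data.Fin using (Fin; toℕ) renaming (zero to fzero; suc to fsuc)
open import Data.Bool using (Bool; true; false; if_then_else_)
open import Data.Product using (Σ; ∃; ∃-syntax; _×_; _,_)
open import Relation.Binary.PropositionalEquality using (_≡_; _≢_)
open import Data.Fin using (_≟_)
open import Relation.Nullary.Decidable using (does)

sumFin : ∀ {n} → (Fin n → ℕ) → ℕ
sumFin {zero}  f = 0
sumFin {suc n} f = f fzero + sumFin (λ i → f (fsuc i))

record Graph (n : ℕ) : Set where
  field
    adj     : Fin n → Fin n → Bool
    adj-sym : ∀ i j → adj i j ≡ adj j i
    adj-irr : ∀ i → adj i i ≡ false
open Graph public

indicator : Bool → ℕ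
indicator true  = 1
indicator false = 0

A : ∀ {n} → Graph n → Fin n → Fin n → ℕ
A G i j = indicator (adj G i j)

deg : ∀ {n} → Graph n → Fin n → ℕ
deg G i = sumFin (λ j → A G i j)

sumEdges : ∀ {n} → Graph n → (Fin n → Fin n → ℕ) → ℕ
sumEdges G f = sumFin (λ i → sumFin (λ j →
  if adj G i j then (if does (toℕ i <? toℕ j) then f i j else 0) else 0))

data Reach {n} (G : Graph n) : Fin n → Fin n → Set where
  here : ∀ {i} → Reach G i i
  step : ∀ {i j k} → adj G i j ≡ true → Reach G j k → Reach G i k

Connected : ∀ {n} → Graph n → Set
Connected G = ∀ i j → Reach G i j

M1 : ∀ {n} → Graph n → ℕ
M1 G = sumFin (λ i → deg G i ^ 2)

M2 : ∀ {n} → Graph n → ℕ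
M2 G = sumEdges G (λ i j → deg G i * deg G j)

F : ∀ {n} → Graph n → ℕ
F G = sumFin (λ i → deg G i ^ 3)

X3 : ∀ {n} → Graph n → ℕ
X3 G = sumEdges G (λ i j → (deg G i + deg G j) ^ 3)

Q : ∀ {n} → Graph n → Fin n → Fin n → ℕ
Q G i j = (if does (i ≟ j) then deg G i else 0) + A G i j

dQd : ∀ {n} → Graph n → ℕ
dQd G = sumFin (λ i → sumFin (λ j → deg G i * Q G i j * deg G j))

Regular : ∀ {n} → Graph n → Set
Regular G = ∃[ k ] (∀ i → deg G i ≡ k)

Semiregular : ∀ {n} → Graph n → Set
Semiregular {n} G =
  Connected G ×
  Σ (Fin n → Bool) λ part →
    (∀ i j → adj G i j ≡ true → part i ≢ part j) ×
    ∃[ a ] ∃[ b ] (a ≢ b ×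
      (∀ i → part i ≡ false → deg G i ≡ a) ×
      (∀ i → part i ≡ true  → deg G i ≡ b) ×
      (∃[ i ] part i ≡ false) × (∃[ j ] part j ≡ true))

-- Write sᵢⱼ = dᵢ + dⱼ for an edge (i, j). Double counting, ∑ᵢ dᵢ gᵢ = ∑_{(i,j) ∈ E} (gᵢ + gⱼ),
-- gives M₁ = ∑_E s and F + 2M₂ = ∑_E s², while X₃ = ∑_E s³; so the inequality is the
-- Cauchy–Schwarz inequality (∑_E s·s)² ≤ (∑_E s)(∑_E s·s²), valid for every monotone linear
-- functional since ∑_a ∑_b w_a w_b (x_a − x_b)² ≥ 0. Expanding Q = D + A gives
-- dᵀQd = ∑ᵢ dᵢ³ + ∑ᵢ ∑ⱼ Aᵢⱼ dᵢ dⱼ = F + 2M₂. In a regular or semiregular graph s is constant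
-- on the edges, which makes Cauchy–Schwarz an equality.
module Submission where

open import Defs
open import Data.Nat using (ℕ; zero; suc; _+_; _*_; _^_; _≤_; _<?_)
open import Data.Nat.Properties hiding (_≟_)
open import Data.Nat.Solver using (module +-*-Solver)
open import Data.Nat.Tactic.RingSolver using (solve-∀)
open import Data.Fin using (Fin; toℕ; _≟_) renaming (zero to fzero; suc to fsuc)
open import Data.Fin.Properties using (toℕ-injective)
open import Data.Bool using (true; false; if_then_else_)
open import Data.Product using (_×_; _,_; proj₂; ∃-syntax; uncurry)
open import Data.Sum using (_⊎_; inj₁; inj₂; [_,_]′)
open import Relation.Nullary.Negation using (contradiction)
open import Relation.Nullary.Decidable using (does; dec-true; dec-false)
open import Relation.Binary using (tri<; tri≈; tri>)
open import Relation.Binary.PropositionalEquality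
open import Function using (_∘_)

open import Algebra.Properties.CommutativeSemigroup +-commutativeSemigroup using (interchange)
open +-*-Solver using (solve; _:+_; _:*_; _:^_; _:=_; con)

sumFin-cong : ∀ {n} {f g : Fin n → ℕ} → (∀ i → f i ≡ g i) → sumFin f ≡ sumFin g
sumFin-cong {zero}  f≗g = refl
sumFin-cong {suc n} f≗g = cong₂ _+_ (f≗g fzero) (sumFin-cong (f≗g ∘ fsuc))

sumFin-mono : ∀ {n} {f g : Fin n → ℕ} → (∀ i → f i ≤ g i) → sumFin f ≤ sumFin g
sumFin-mono {zero}  f≤g = ≤-refl
sumFin-mono {suc n} f≤g = +-mono-≤ (f≤g fzero) (sumFin-mono (f≤g ∘ fsuc))

sumFin-+ : ∀ {n} (f g : Fin n → ℕ) → sumFin (λ i → f i + g i) ≡ sumFin f + sumFin g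
sumFin-+ {zero}  f g = refl
sumFin-+ {suc n} f g = begin
  f fzero + g fzero + sumFin (λ i → f (fsuc i) + g (fsuc i))
    ≡⟨ cong (f fzero + g fzero +_) (sumFin-+ (f ∘ fsuc) (g ∘ fsuc)) ⟩
  f fzero + g fzero + (sumFin (f ∘ fsuc) + sumFin (g ∘ fsuc))
    ≡⟨ interchange (f fzero) (g fzero) _ _ ⟩
  f fzero + sumFin (f ∘ fsuc) + (g fzero + sumFin (g ∘ fsuc)) ∎
  where open ≡-Reasoning

sumFin-*ˡ : ∀ {n} c (f : Fin n → ℕ) → sumFin (λ i → c * f i) ≡ c * sumFin f
sumFin-*ˡ {zero}  c f = sym (*-zeroʳ c)
sumFin-*ˡ {suc n} c f =
  trans (cong (c * f fzero +_) (sumFin-*ˡ c (f ∘ fsuc))) (sym (*-distribˡ-+ c _ _))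

sumFin-*ʳ : ∀ {n} c (f : Fin n → ℕ) → sumFin (λ i → f i * c) ≡ sumFin f * c
sumFin-*ʳ c f = begin
  sumFin (λ i → f i * c) ≡⟨ sumFin-cong (λ i → *-comm (f i) c) ⟩
  sumFin (λ i → c * f i) ≡⟨ sumFin-*ˡ c f ⟩
  c * sumFin f           ≡⟨ *-comm c (sumFin f) ⟩
  sumFin f * c           ∎
  where open ≡-Reasoning

sumFin-0 : ∀ {n} → sumFin {n} (λ _ → 0) ≡ 0
sumFin-0 {zero}  = refl
sumFin-0 {suc n} = sumFin-0 {n}

sumFin-swap : ∀ {m n} (h : Fin m → Fin n → ℕ) →
  sumFin (λ i → sumFin (h i)) ≡ sumFin (λ j → sumFin (λ i → h i j))
sumFin-swap {zero}  {n} h = sym (sumFin-0 {n})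
sumFin-swap {suc m}     h =
  trans (cong (sumFin (h fzero) +_) (sumFin-swap (h ∘ fsuc)))
        (sym (sumFin-+ (h fzero) _))

sumFin-δ : ∀ {n} (i : Fin n) (g : Fin n → ℕ) →
  sumFin (λ j → if does (i ≟ j) then g j else 0) ≡ g i
sumFin-δ {suc n} fzero g = trans (cong (g fzero +_) (sumFin-0 {n})) (+-identityʳ (g fzero))
sumFin-δ (fsuc i) g = sumFin-δ i (g ∘ fsuc)

2*m*n≤m^2+n^2 : ∀ m n → 2 * m * n ≤ m ^ 2 + n ^ 2
2*m*n≤m^2+n^2 m n = [ ordered , swapped ]′ (≤-total m n)
  where
  ordered : ∀ {m n} → m ≤ n → 2 * m * n ≤ m ^ 2 + n ^ 2
  ordered {m} m≤n with m≤n⇒∃[o]m+o≡n m≤n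
  ... | k , refl = ≤-trans (m≤m+n _ (k ^ 2)) (≤-reflexive (sym (expand m k)))
    where
    expand : ∀ m k → m ^ 2 + (m + k) ^ 2 ≡ 2 * m * (m + k) + k ^ 2
    expand = solve 2 (λ m k → m :^ 2 :+ (m :+ k) :^ 2 := con 2 :* m :* (m :+ k) :+ k :^ 2) refl
  swapped : n ≤ m → 2 * m * n ≤ m ^ 2 + n ^ 2
  swapped n≤m = subst₂ _≤_ (solve 2 (λ m n → con 2 :* n :* m := con 2 :* m :* n) refl m n)
                           (+-comm (n ^ 2) (m ^ 2)) (ordered n≤m)

module PositiveLinear {I : Set} (∑ : (I → ℕ) → ℕ)
  (∑-+ : ∀ f g → ∑ (λ a → f a + g a) ≡ ∑ f + ∑ g)
  (∑-*ˡ : ∀ c f → ∑ (λ a → c * f a) ≡ c * ∑ f)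
  (∑-mono : ∀ {f g} → (∀ a → f a ≤ g a) → ∑ f ≤ ∑ g)
  where

  ∑-cong : ∀ {f g} → (∀ a → f a ≡ g a) → ∑ f ≡ ∑ g
  ∑-cong f≗g = ≤-antisym (∑-mono (≤-reflexive ∘ f≗g)) (∑-mono (≤-reflexive ∘ sym ∘ f≗g))

  ∑*∑≡∑∑ : ∀ f g → ∑ f * ∑ g ≡ ∑ (λ a → ∑ (λ b → f a * g b))
  ∑*∑≡∑∑ f g = begin
    ∑ f * ∑ g                      ≡⟨ *-comm (∑ f) (∑ g) ⟩
    ∑ g * ∑ f                      ≡⟨ ∑-*ˡ (∑ g) f ⟨
    ∑ (λ a → ∑ g * f a)            ≡⟨ ∑-cong (λ a → trans (*-comm (∑ g) (f a)) (sym (∑-*ˡ (f a) g))) ⟩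
    ∑ (λ a → ∑ (λ b → f a * g b))  ∎
    where open ≡-Reasoning

  cauchy-schwarz : (w x : I → ℕ) → ∑ (λ a → w a * x a) ^ 2 ≤ ∑ w * ∑ (λ a → w a * x a ^ 2)
  cauchy-schwarz w x = *-cancelˡ-≤ {∑ wx ^ 2} {∑ w * ∑ wx²} 2 (begin
    2 * ∑ wx ^ 2
      ≡⟨ cong (λ t → 2 * (∑ wx * t)) (*-identityʳ (∑ wx)) ⟩
    2 * (∑ wx * ∑ wx)
      ≡⟨ cong (2 *_) (∑*∑≡∑∑ wx wx) ⟩
    2 * ∑ (λ a → ∑ (λ b → wx a * wx b))
      ≡⟨ ∑-*ˡ 2 (λ a → ∑ (λ b → wx a * wx b)) ⟨
    ∑ (λ a → 2 * ∑ (λ b → wx a * wx b))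
      ≡⟨ ∑-cong (λ a → ∑-*ˡ 2 (λ b → wx a * wx b)) ⟨
    ∑ (λ a → ∑ (λ b → 2 * (wx a * wx b)))
      ≤⟨ ∑-mono (λ a → ∑-mono (λ b → cross-term a b)) ⟩
    ∑ (λ a → ∑ (λ b → w a * wx² b + wx² a * w b))
      ≡⟨ ∑-cong (λ a → ∑-+ (λ b → w a * wx² b) (λ b → wx² a * w b)) ⟩
    ∑ (λ a → ∑ (λ b → w a * wx² b) + ∑ (λ b → wx² a * w b))
      ≡⟨ ∑-+ (λ a → ∑ (λ b → w a * wx² b)) (λ a → ∑ (λ b → wx² a * w b)) ⟩
    ∑ (λ a → ∑ (λ b → w a * wx² b)) + ∑ (λ a → ∑ (λ b → wx² a * w b))
      ≡⟨ cong₂ _+_ (∑*∑≡∑∑ w wx²) (∑*∑≡∑∑ wx² w) ⟨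
    ∑ w * ∑ wx² + ∑ wx² * ∑ w
      ≡⟨ double (∑ w) (∑ wx²) ⟩
    2 * (∑ w * ∑ wx²) ∎)
    where
    open ≤-Reasoning
    wx wx² : I → ℕ
    wx a = w a * x a
    wx² a = w a * x a ^ 2
    double : ∀ p q → p * q + q * p ≡ 2 * (p * q)
    double = solve-∀
    cross-term : ∀ a b → 2 * (wx a * wx b) ≤ w a * wx² b + wx² a * w b
    cross-term a b =
      subst₂ _≤_ (regroup (w a) (w b) (x a) (x b)) (regroup² (w a) (w b) (x a) (x b))
        (*-monoʳ-≤ (w a * w b) (2*m*n≤m^2+n^2 (x a) (x b)))
      where
      regroup : ∀ u v p q → u * v * (2 * p * q) ≡ 2 * (u * p * (v * q))
      regroup = solve 4 (λ u v p q → u :* v :* (con 2 :* p :* q) := con 2 :* (u :* p :* (v :* q))) refl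
      regroup² : ∀ u v p q → u * v * (p ^ 2 + q ^ 2) ≡ u * (v * q ^ 2) + u * p ^ 2 * v
      regroup² = solve 4 (λ u v p q → u :* v :* (p :^ 2 :+ q :^ 2)
                                    := u :* (v :* q :^ 2) :+ u :* p :^ 2 :* v) refl

module _ {n} (G : Graph n) where

  onEdge : Fin n → Fin n → ℕ → ℕ
  onEdge i j x = if adj G i j then (if does (toℕ i <? toℕ j) then x else 0) else 0

  onEdge-+ : ∀ i j x y → onEdge i j (x + y) ≡ onEdge i j x + onEdge i j y
  onEdge-+ i j x y with adj G i j | does (toℕ i <? toℕ j)
  ... | true  | true  = refl
  ... | true  | false = refl
  ... | false | _     = refl

  onEdge-*ˡ : ∀ i j c x → onEdge i j (c * x) ≡ c * onEdge i j x
  onEdge-*ˡ i j c x with adj G i j | does (toℕ i <? toℕ j)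
  ... | true  | true  = refl
  ... | true  | false = sym (*-zeroʳ c)
  ... | false | _     = sym (*-zeroʳ c)

  onEdge-mono : ∀ i j {x y} → x ≤ y → onEdge i j x ≤ onEdge i j y
  onEdge-mono i j x≤y with adj G i j | does (toℕ i <? toℕ j)
  ... | true  | true  = x≤y
  ... | true  | false = ≤-refl
  ... | false | _     = ≤-refl

  onEdge-cong : ∀ i j {x y} → (adj G i j ≡ true → x ≡ y) → onEdge i j x ≡ onEdge i j y
  onEdge-cong i j x≡y with adj G i j
  ... | true  = cong (λ z → if does (toℕ i <? toℕ j) then z else 0) (x≡y refl)
  ... | false = refl

  A*≡onEdge+onEdge : ∀ i j x → A G i j * x ≡ onEdge i j x + onEdge j i x
  A*≡onEdge+onEdge i j x rewrite adj-sym G j i with adj G i j in ij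
  ... | false = refl
  ... | true with <-cmp (toℕ i) (toℕ j)
  ...   | tri< i<j _ j≮i rewrite dec-true (toℕ i <? toℕ j) i<j | dec-false (toℕ j <? toℕ i) j≮i =
          trans (*-identityˡ x) (sym (+-identityʳ x))
  ...   | tri> i≮j _ j<i rewrite dec-false (toℕ i <? toℕ j) i≮j | dec-true (toℕ j <? toℕ i) j<i =
          *-identityˡ x
  ...   | tri≈ _ i≡j _ with toℕ-injective i≡j
  ...     | refl = contradiction (trans (sym ij) (adj-irr G i)) λ ()

  sumEdges-+ : (f g : Fin n → Fin n → ℕ) →
    sumEdges G (λ i j → f i j + g i j) ≡ sumEdges G f + sumEdges G g
  sumEdges-+ f g = trans
    (sumFin-cong (λ i → trans (sumFin-cong (λ j → onEdge-+ i j (f i j) (g i j)))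
                              (sumFin-+ (λ j → onEdge i j (f i j)) (λ j → onEdge i j (g i j)))))
    (sumFin-+ (λ i → sumFin (λ j → onEdge i j (f i j))) (λ i → sumFin (λ j → onEdge i j (g i j))))

  sumEdges-*ˡ : ∀ c (f : Fin n → Fin n → ℕ) → sumEdges G (λ i j → c * f i j) ≡ c * sumEdges G f
  sumEdges-*ˡ c f = trans
    (sumFin-cong (λ i → trans (sumFin-cong (λ j → onEdge-*ˡ i j c (f i j)))
                              (sumFin-*ˡ c (λ j → onEdge i j (f i j)))))
    (sumFin-*ˡ c (λ i → sumFin (λ j → onEdge i j (f i j))))

  sumEdges-mono : ∀ {f g} → (∀ i j → f i j ≤ g i j) → sumEdges G f ≤ sumEdges G g
  sumEdges-mono f≤g = sumFin-mono (λ i → sumFin-mono (λ j → onEdge-mono i j (f≤g i j)))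

  sumEdges-cong : ∀ {f g} → (∀ i j → adj G i j ≡ true → f i j ≡ g i j) →
    sumEdges G f ≡ sumEdges G g
  sumEdges-cong f≗g = sumFin-cong (λ i → sumFin-cong (λ j → onEdge-cong i j (f≗g i j)))

  sumFin-A* : (h : Fin n → Fin n → ℕ) → sumFin (λ i → sumFin (λ j → A G i j * h i j)) ≡
                    sumEdges G (λ i j → h i j + h j i)
  sumFin-A* h = begin
    sumFin (λ i → sumFin (λ j → A G i j * h i j))
      ≡⟨ sumFin-cong (λ i → trans (sumFin-cong (λ j → A*≡onEdge+onEdge i j (h i j)))
                                  (sumFin-+ (λ j → onEdge i j (h i j)) (λ j → onEdge j i (h i j)))) ⟩
    sumFin (λ i → sumFin (λ j → onEdge i j (h i j)) + sumFin (λ j → onEdge j i (h i j)))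
      ≡⟨ sumFin-+ (λ i → sumFin (λ j → onEdge i j (h i j))) (λ i → sumFin (λ j → onEdge j i (h i j))) ⟩
    sumEdges G h + sumFin (λ i → sumFin (λ j → onEdge j i (h i j)))
      ≡⟨ cong (sumEdges G h +_) (sumFin-swap (λ i j → onEdge j i (h i j))) ⟩
    sumEdges G h + sumEdges G (λ i j → h j i)
      ≡⟨ sumEdges-+ h (λ i j → h j i) ⟨
    sumEdges G (λ i j → h i j + h j i) ∎
    where open ≡-Reasoning

  sumFin-deg* : (g : Fin n → ℕ) → sumFin (λ i → deg G i * g i) ≡ sumEdges G (λ i j → g i + g j)
  sumFin-deg* g = trans (sumFin-cong (λ i → sym (sumFin-*ʳ (g i) (A G i)))) (sumFin-A* (λ i _ → g i))

  degreeSum : Fin n → Fin n → ℕ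
  degreeSum i j = deg G i + deg G j

  edgeCount : ℕ
  edgeCount = sumEdges G (λ _ _ → 1)

  open PositiveLinear {Fin n × Fin n} (λ f → sumEdges G (λ i j → f (i , j)))
    (λ f g → sumEdges-+ (λ i j → f (i , j)) (λ i j → g (i , j)))
    (λ c f → sumEdges-*ˡ c (λ i j → f (i , j)))
    (λ f≤g → sumEdges-mono (λ i j → f≤g (i , j)))

  F+2M2≡∑degreeSum² : F G + 2 * M2 G ≡ sumEdges G (λ i j → degreeSum i j ^ 2)
  F+2M2≡∑degreeSum² = begin
    F G + 2 * M2 G
      ≡⟨ cong₂ _+_ (sumFin-deg* (λ i → deg G i ^ 2)) (sym (sumEdges-*ˡ 2 cross)) ⟩
    sumEdges G squares + sumEdges G (λ i j → 2 * cross i j)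
      ≡⟨ sumEdges-+ squares (λ i j → 2 * cross i j) ⟨
    sumEdges G (λ i j → squares i j + 2 * cross i j)
      ≡⟨ sumEdges-cong (λ i j _ → square-of-sum (deg G i) (deg G j)) ⟩
    sumEdges G (λ i j → degreeSum i j ^ 2) ∎
    where
    open ≡-Reasoning
    squares cross : Fin n → Fin n → ℕ
    squares i j = deg G i ^ 2 + deg G j ^ 2
    cross i j = deg G i * deg G j
    square-of-sum : ∀ a b → a ^ 2 + b ^ 2 + 2 * (a * b) ≡ (a + b) ^ 2
    square-of-sum = solve 2 (λ a b → a :^ 2 :+ b :^ 2 :+ con 2 :* (a :* b) := (a :+ b) :^ 2) refl

  M1≡∑degreeSum : M1 G ≡ sumEdges G degreeSum
  M1≡∑degreeSum = trans (sumFin-cong (λ i → cong (deg G i *_) (*-identityʳ (deg G i))))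
                        (sumFin-deg* (deg G))

  dQd≡F+2M2 : dQd G ≡ F G + 2 * M2 G
  dQd≡F+2M2 = begin
    dQd G
      ≡⟨ sumFin-cong (λ i → trans (sumFin-cong (expand-Q i)) (sumFin-+ (diagonal i) (offDiagonal i))) ⟩
    sumFin (λ i → sumFin (diagonal i) + sumFin (offDiagonal i))
      ≡⟨ sumFin-+ (λ i → sumFin (diagonal i)) (λ i → sumFin (offDiagonal i)) ⟩
    sumFin (λ i → sumFin (diagonal i)) + sumFin (λ i → sumFin (offDiagonal i))
      ≡⟨ cong₂ _+_ (sumFin-cong (λ i → trans (sumFin-δ i (λ j → deg G i * deg G i * deg G j))
                                              (cube (deg G i))))
                   (sumFin-A* (λ i j → deg G i * deg G j)) ⟩
    F G + sumEdges G (λ i j → deg G i * deg G j + deg G j * deg G i)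
      ≡⟨ cong (F G +_) (trans (sumEdges-cong (λ i j _ → double (deg G i) (deg G j)))
                              (sumEdges-*ˡ 2 (λ i j → deg G i * deg G j))) ⟩
    F G + 2 * M2 G ∎
    where
    open ≡-Reasoning
    diagonal offDiagonal : Fin n → Fin n → ℕ
    diagonal i j = if does (i ≟ j) then deg G i * deg G i * deg G j else 0
    offDiagonal i j = A G i j * (deg G i * deg G j)
    expand-Q : ∀ i j → deg G i * Q G i j * deg G j ≡ diagonal i j + offDiagonal i j
    expand-Q i j with does (i ≟ j)
    ... | true  = on-diagonal (deg G i) (A G i j) (deg G j)
      where
      on-diagonal : ∀ d a e → d * (d + a) * e ≡ d * d * e + a * (d * e)
      on-diagonal = solve-∀
    ... | false = off-diagonal (deg G i) (A G i j) (deg G j)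
      where
      off-diagonal : ∀ d a e → d * a * e ≡ a * (d * e)
      off-diagonal = solve-∀
    cube : ∀ a → a * a * a ≡ a ^ 3
    cube = solve 1 (λ a → a :* a :* a := a :^ 3) refl
    double : ∀ a b → a * b + b * a ≡ 2 * (a * b)
    double = solve-∀

  [F+2M2]²≤X3*M1 : (F G + 2 * M2 G) ^ 2 ≤ X3 G * M1 G
  [F+2M2]²≤X3*M1 = begin
    (F G + 2 * M2 G) ^ 2
      ≡⟨ cong (_^ 2) (trans F+2M2≡∑degreeSum²
                            (sumEdges-cong (λ i j _ → cong (degreeSum i j *_) (*-identityʳ _)))) ⟩
    sumEdges G (λ i j → degreeSum i j * degreeSum i j) ^ 2
      ≤⟨ cauchy-schwarz (uncurry degreeSum) (uncurry degreeSum) ⟩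
    sumEdges G degreeSum * X3 G
      ≡⟨ cong (_* X3 G) M1≡∑degreeSum ⟨
    M1 G * X3 G
      ≡⟨ *-comm (M1 G) (X3 G) ⟩
    X3 G * M1 G ∎
    where open ≤-Reasoning

  sumEdges-constant : ∀ {f} c → (∀ i j → adj G i j ≡ true → f i j ≡ c) →
    sumEdges G f ≡ c * edgeCount
  sumEdges-constant c f≡c = trans (sumEdges-cong (λ i j e → trans (f≡c i j e) (sym (*-identityʳ c))))
                                  (sumEdges-*ˡ c (λ _ _ → 1))

  [F+2M2]²≡X3*M1 : ∀ {c} → (∀ i j → adj G i j ≡ true → degreeSum i j ≡ c) →
    (F G + 2 * M2 G) ^ 2 ≡ X3 G * M1 G
  [F+2M2]²≡X3*M1 {c} constant = begin
    (F G + 2 * M2 G) ^ 2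
      ≡⟨ cong (_^ 2) (trans F+2M2≡∑degreeSum² (sumEdges-constant (c ^ 2) (powers 2))) ⟩
    (c ^ 2 * edgeCount) ^ 2
      ≡⟨ balance c edgeCount ⟩
    c ^ 3 * edgeCount * (c * edgeCount)
      ≡⟨ cong₂ _*_ (sumEdges-constant (c ^ 3) (powers 3))
                   (trans M1≡∑degreeSum (sumEdges-constant c constant)) ⟨
    X3 G * M1 G ∎
    where
    open ≡-Reasoning
    powers : ∀ k i j → adj G i j ≡ true → degreeSum i j ^ k ≡ c ^ k
    powers k i j e = cong (_^ k) (constant i j e)
    balance : ∀ c m → (c ^ 2 * m) ^ 2 ≡ c ^ 3 * m * (c * m)
    balance = solve 2 (λ c m → (c :^ 2 :* m) :^ 2 := c :^ 3 :* m :* (c :* m)) refl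

  regular⊎semiregular⇒degreeSum-constant : Regular G ⊎ Semiregular G →
    ∃[ c ] (∀ i j → adj G i j ≡ true → degreeSum i j ≡ c)
  regular⊎semiregular⇒degreeSum-constant (inj₁ (k , deg≡k)) =
    k + k , λ i j _ → cong₂ _+_ (deg≡k i) (deg≡k j)
  regular⊎semiregular⇒degreeSum-constant (inj₂ (_ , part , bipartite , a , b , _ , deg≡a , deg≡b , _)) =
    a + b , across
    where
    across : ∀ i j → adj G i j ≡ true → degreeSum i j ≡ a + b
    across i j ij with part i in pi | part j in pj | bipartite i j ij
    ... | false | false | ≢ = contradiction refl ≢
    ... | true  | true  | ≢ = contradiction refl ≢
    ... | false | true  | _ = cong₂ _+_ (deg≡a i pi) (deg≡b j pj)
    ... | true  | false | _ = trans (cong₂ _+_ (deg≡b i pi) (deg≡a j pj)) (+-comm b a)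

proposition9 : (n : ℕ) → 3 ≤ n → (G : Graph n) → Connected G →
    ((F G + 2 * M2 G) ^ 2 ≤ X3 G * M1 G) ×
    (F G + 2 * M2 G ≡ dQd G) ×
    (Regular G ⊎ Semiregular G → (F G + 2 * M2 G) ^ 2 ≡ X3 G * M1 G)
proposition9 n _ G _ =
  [F+2M2]²≤X3*M1 G ,
  sym (dQd≡F+2M2 G) ,
  λ reg⊎semireg → [F+2M2]²≡X3*M1 G (proj₂ (regular⊎semiregular⇒degreeSum-constant G reg⊎semireg))
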